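{- For a positive integer $k$, let $G_k$ be the graph with vertex set $[k]\cup\binom{[k]}{2}$, where $[k]=\{1,\dots,k\}$ and $\binom{[k]}{2}$ is the set of unordered pairs $\{i,j\}$ of distinct elements of $[k]$, in which each vertex $\{i,j\}$ is adjacent exactly to $i$ and $j$ (and there are no other edges). Then $G_k$ has at least $S(k,3)$ free potential maximal cliques $\Omega$ with $\Omega\cap[k]=\emptyset$.
   Context: $S(n,m)$ denotes the Stirling number of the second kind, the number of partitions of an $n$-element set into $m$ non-empty parts. A triangulation of a graph $G$ is a chordal graph on $V(G)$ containing $E(G)$; it is minimal if no triangulation has an edge set that is a proper subset of its edge set. A potential maximal clique (PMC) of $G$ is a maximal clique of some minimal triangulation of $G$. A PMC $\Omega$ is free if every vertex of $\Omega$ is adjacent to some vertex of $V(G)\setminus\Omega$. -}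

module Defs where

open import Level using (Level) renaming (suc to lsuc; zero to lzero)
open import Data.Nat as ℕ using (ℕ; zero; suc; _+_; _*_; _∸_)
open import Data.Fin using (Fin; toℕ) renaming (_<_ to _<ᶠ_)
open import Data.Bool using (Bool; true; false)
open import Data.Product using (Σ; ∃; ∃-syntax; _×_; _,_; proj₁; proj₂)
open import Data.Sum using (_⊎_; inj₁; inj₂)
open import Data.Empty using (⊥)
open import Relation.Nullary using (¬_)
open import Relation.Binary.PropositionalEquality using (_≡_; _≢_)

S : ℕ → ℕ → ℕ
S zero    zero    = 1
S zero    (suc m) = 0
S (suc n) zero    = 0
S (suc n) (suc m) = suc m * S n (suc m) + S n m

Rel : Set → Set₁
Rel V = V → V → Set

IsGraph : {V : Set} → Rel V → Set
IsGraph {V} E = (∀ u v → E u v → E v u) × (∀ v → ¬ E v v)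

Subset : Set → Set
Subset V = V → Bool

_∈_ : {V : Set} → V → Subset V → Set
v ∈ Ω = Ω v ≡ true

_∉_ : {V : Set} → V → Subset V → Set
v ∉ Ω = Ω v ≡ false

_⊆_ : {V : Set} → Subset V → Subset V → Set
A ⊆ B = ∀ v → v ∈ A → v ∈ B

CycNext : (m : ℕ) → Fin m → Fin m → Set
CycNext m i j = (toℕ j ≡ suc (toℕ i)) ⊎ ((suc (toℕ i) ≡ m) × (toℕ j ≡ 0))

IsCycle : {V : Set} → Rel V → (m : ℕ) → (Fin m → V) → Set
IsCycle E m c =
  (∀ i j → c i ≡ c j → i ≡ j) × (∀ i j → CycNext m i j → E (c i) (c j))

HasChord : {V : Set} → Rel V → (m : ℕ) → (Fin m → V) → Set
HasChord E m c =
  ∃[ i ] ∃[ j ] (i ≢ j × ¬ CycNext m i j × ¬ CycNext m j i × E (c i) (c j))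

Chordal : {V : Set} → Rel V → Set
Chordal {V} E = ∀ m → 4 ℕ.≤ m → (c : Fin m → V) → IsCycle E m c → HasChord E m c

IsTriangulation : {V : Set} → Rel V → Rel V → Set
IsTriangulation G H = IsGraph H × (∀ u v → G u v → H u v) × Chordal H

IsMinimalTriangulation : {V : Set} → Rel V → Rel V → Set₁
IsMinimalTriangulation {V} G H =
  IsTriangulation G H ×
  ((H' : Rel V) → IsTriangulation G H' →
     (∀ u v → H' u v → H u v) → ¬ (∃[ u ] ∃[ v ] (H u v × ¬ H' u v)))

IsClique : {V : Set} → Rel V → Subset V → Set
IsClique E Ω = ∀ u v → u ∈ Ω → v ∈ Ω → u ≢ v → E u v

IsMaximalClique : {V : Set} → Rel V → Subset V → Set
IsMaximalClique {V} E Ω =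
  IsClique E Ω × ((Ω' : Subset V) → IsClique E Ω' → Ω ⊆ Ω' → Ω' ⊆ Ω)

IsPMC : {V : Set} → Rel V → Subset V → Set₁
IsPMC {V} G Ω = Σ (Rel V) λ H → IsMinimalTriangulation G H × IsMaximalClique H Ω

IsFree : {V : Set} → Rel V → Subset V → Set
IsFree G Ω = ∀ v → v ∈ Ω → ∃[ u ] (u ∉ Ω × G v u)

-- Vertices: [k] (as Fin k, via inj₁) and unordered pairs
-- {i,j} of distinct elements, represented uniquely as (i , j) with i < j
-- (via inj₂).

Pair : ℕ → Set
Pair k = Σ (Fin k × Fin k) λ p → proj₁ p <ᶠ proj₂ p

Vk : ℕ → Set
Vk k = Fin k ⊎ Pair k

InPair : {k : ℕ} → Fin k → Pair k → Set
InPair i ((a , b) , _) = (i ≡ a) ⊎ (i ≡ b)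

Gk : (k : ℕ) → Rel (Vk k)
Gk k (inj₁ i) (inj₁ j) = ⊥
Gk k (inj₁ i) (inj₂ p) = InPair i p
Gk k (inj₂ p) (inj₁ i) = InPair i p
Gk k (inj₂ p) (inj₂ q) = ⊥

-- Fix a partition of [k] into three labelled blocks (`partition` enumerates
-- the S(k,3) of them) and let Ω be the set of pairs {i,j} whose elements lie in
-- different blocks.  Ω contains no element, is free (the pair {i,j} has the
-- neighbour i outside Ω), and determines the partition.  It is a maximal clique
-- of the graph H obtained from G_k by making every block a clique and Ω a
-- clique, and by joining an element a to each pair of Ω that contains a or a
-- block-mate of a larger than a.  H is chordal, because in the order
-- "same-block pairs, elements from the largest down, Ω" the later neighbours of
-- every vertex form a clique.  H is a minimal triangulation: every edge uv of H
-- splits a 6- or 8-cycle of G_k into two arcs spanning no edge of H, and in a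
-- chordal subgraph of H containing G_k such a cycle must be chorded by uv.

module Submission where

open import Defs
open import Data.Bool using (true; false; not; if_then_else_)
open import Data.Empty using (⊥-elim)
open import Data.Fin as Fin using (Fin; zero; suc; toℕ; splitAt; join; remQuot; combine)
open import Data.Fin.Properties as Fin using (join-splitAt; combine-remQuot; suc-injective)
open import Data.List using (List; []; _∷_; _++_; [_]; length; lookup)
open import Data.List.Properties using (++-assoc; length-++; ∷-injective)
open import Data.List.Membership.Propositional using () renaming (_∈_ to _∈ˡ_)
open import Data.List.Membership.Propositional.Properties using (∈-lookup; ∈-++⁺ʳ)
open import Data.List.Relation.Unary.All as All using ([]; _∷_)
open import Data.List.Relation.Unary.Any using (here; there)
open import Data.List.Relation.Unary.Linked as Linked using (Linked; []; [-]; _∷_)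
open import Data.List.Relation.Unary.Unique.Propositional using (Unique; []; _∷_)
open import Data.List.Relation.Binary.Sublist.Propositional as Sublist
  using ([]; _∷ʳ_; _∷_; ⊆-refl) renaming (_⊆_ to _⊑_)
open import Data.List.Relation.Binary.Sublist.Propositional.Properties using (++⁺; ++⁺ˡ; All-resp-⊆)
open import Data.Nat using (ℕ; zero; suc; _+_; _*_; _∸_; _≤_; _<_; z≤n; s≤s; _≤?_; _<?_)
open import Data.Nat.Induction using (<-wellFounded)
open import Data.Nat.Properties as ℕ using ()
open import Data.Product using (Σ; ∃; ∃₂; ∃-syntax; _×_; _,_; proj₁; proj₂; uncurry)
open import Data.Sum using (_⊎_; inj₁; inj₂)
open import Data.Vec as Vec using (_∷_; [])
open import Function using (_∘_)
open import Induction.WellFounded using (Acc; acc)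
open import Relation.Nullary using (¬_; Dec; yes; no; does; ¬?)
open import Relation.Nullary.Decidable using (dec-true; dec-false; decidable-stable)
open import Relation.Binary.Definitions using (tri<; tri≈; tri>)
open import Relation.Binary.PropositionalEquality
  using (_≡_; _≢_; refl; sym; trans; cong; cong₂; subst; subst₂)

module _ {A : Set} where

  Unique-resp-⊇ : {xs ys : List A} → xs ⊑ ys → Unique ys → Unique xs
  Unique-resp-⊇ []         []       = []
  Unique-resp-⊇ (y ∷ʳ τ)   (_ ∷ u)  = Unique-resp-⊇ τ u
  Unique-resp-⊇ (refl ∷ τ) (x∉ ∷ u) = All-resp-⊆ τ x∉ ∷ Unique-resp-⊇ τ u

  lookup-injective : {w : List A} → Unique w → ∀ i j → lookup w i ≡ lookup w j → i ≡ j
  lookup-injective (_ ∷ _)  zero    zero    _  = refl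
  lookup-injective (x∉ ∷ _) zero    (suc j) eq = ⊥-elim (All.lookup x∉ (∈-lookup j) eq)
  lookup-injective (x∉ ∷ _) (suc i) zero    eq = ⊥-elim (All.lookup x∉ (∈-lookup i) (sym eq))
  lookup-injective (_ ∷ u)  (suc i) (suc j) eq = cong suc (lookup-injective u i j eq)

  ++-∷≢[] : (p : List A) {a : A} {l : List A} → p ++ a ∷ l ≢ []
  ++-∷≢[] []      ()
  ++-∷≢[] (_ ∷ _) ()

  length-++-∷≥3 : ∀ {xs : List A} {v ys} → xs ≢ [] → ys ≢ [] → 3 ≤ length (xs ++ v ∷ ys)
  length-++-∷≥3 {[]}                   xs≢[] _     = ⊥-elim (xs≢[] refl)
  length-++-∷≥3 {_ ∷ _}  {ys = []}     _     ys≢[] = ⊥-elim (ys≢[] refl)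
  length-++-∷≥3 {_ ∷ xs} {ys = _ ∷ ys} _     _     =
    s≤s (subst (2 ≤_) (sym (length-++ xs)) (ℕ.≤-trans (s≤s (s≤s z≤n)) (ℕ.m≤n+m _ (length xs))))

  shortcut-shorter : ∀ (P : List A) {a} Q {b R} → Q ≢ [] →
                     length (P ++ a ∷ b ∷ R) < length (P ++ a ∷ Q ++ b ∷ R)
  shortcut-shorter []      []              Q≢[] = ⊥-elim (Q≢[] refl)
  shortcut-shorter []      (q ∷ Q) {b} {R} _    =
    s≤s (s≤s (subst (suc (length R) ≤_) (sym (length-++ Q)) (ℕ.m≤n+m _ (length Q))))
  shortcut-shorter (x ∷ P) Q               Q≢[] = s≤s (shortcut-shorter P Q Q≢[])

  split-at : ∀ (w : List A) (j : Fin (length w)) → ∃₂ λ Q R →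
             w ≡ Q ++ lookup w j ∷ R × length Q ≡ toℕ j × (R ≡ [] → suc (toℕ j) ≡ length w)
  split-at (x ∷ w) zero    = [] , w , refl , refl , λ { refl → refl }
  split-at (x ∷ w) (suc j) with Q , R , eq , len , last ← split-at w j =
    x ∷ Q , R , cong (x ∷_) eq , cong suc len , λ R≡[] → cong suc (last R≡[])

  split-at₂ : ∀ (w : List A) (i j : Fin (length w)) → toℕ i < toℕ j → toℕ j ≢ suc (toℕ i) →
              ∃₂ λ P Q → ∃ λ R → w ≡ P ++ lookup w i ∷ Q ++ lookup w j ∷ R × Q ≢ []
  split-at₂ (x ∷ w) zero (suc j) _ j≢1 with Q , R , eq , len , _ ← split-at w j =
    [] , Q , R , cong (x ∷_) eq , λ { refl → j≢1 (cong suc (sym len)) }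
  split-at₂ (x ∷ w) (suc i) (suc j) (s≤s i<j) j≢1+i
    with P , Q , R , eq , Q≢[] ← split-at₂ w i j i<j (λ eq → j≢1+i (cong suc eq)) =
    x ∷ P , Q , R , cong (x ∷_) eq , Q≢[]

  data Location (X : List A) (a : A) (Y xs : List A) (v : A) (ys : List A) : Set where
    in-left  : ∀ m → xs ≡ X ++ a ∷ m → Y ≡ m ++ v ∷ ys → Location X a Y xs v ys
    at-pivot : X ≡ xs → a ≡ v → Y ≡ ys → Location X a Y xs v ys
    in-right : ∀ m → X ≡ xs ++ v ∷ m → ys ≡ m ++ a ∷ Y → Location X a Y xs v ys

  locate : ∀ X a Y xs v ys → X ++ a ∷ Y ≡ xs ++ v ∷ ys → Location X a Y xs v ys
  locate []      a Y []       v ys refl = at-pivot refl refl refl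
  locate []      a Y (x ∷ xs) v ys refl = in-left xs refl refl
  locate (x ∷ X) a Y []       v ys refl = in-right X refl refl
  locate (x ∷ X) a Y (y ∷ xs) v ys eq with refl , eq′ ← ∷-injective eq with locate X a Y xs v ys eq′
  ... | in-left m refl refl     = in-left m refl refl
  ... | at-pivot refl refl refl = at-pivot refl refl refl
  ... | in-right m refl refl    = in-right m refl refl

module _ {A : Set} {R : Rel A} where

  linked-suffix : ∀ (xs : List A) {ys} → Linked R (xs ++ ys) → Linked R ys
  linked-suffix []       l = l
  linked-suffix (x ∷ xs) l = linked-suffix xs (Linked.tail l)

  linked-shortcut : ∀ (P : List A) {a} Q {b S} → R a b → Linked R (P ++ a ∷ Q ++ b ∷ S) →
                    Linked R (P ++ a ∷ b ∷ S)
  linked-shortcut []          Q r l        = r ∷ linked-suffix Q (Linked.tail l)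
  linked-shortcut (x ∷ [])    Q r (r′ ∷ l) = r′ ∷ linked-shortcut [] Q r l
  linked-shortcut (x ∷ y ∷ P) Q r (r′ ∷ l) = r′ ∷ linked-shortcut (y ∷ P) Q r l

  linked-lookup-suc : ∀ (w : List A) {s} (i j : Fin (length w)) → toℕ j ≡ suc (toℕ i) →
                      Linked R (w ++ s) → R (lookup w i) (lookup w j)
  linked-lookup-suc (x ∷ [])    zero    zero          ()
  linked-lookup-suc (x ∷ y ∷ w) zero    zero          ()
  linked-lookup-suc (x ∷ y ∷ w) zero    (suc zero)    _  (r ∷ _) = r
  linked-lookup-suc (x ∷ y ∷ w) zero    (suc (suc j)) ()
  linked-lookup-suc (x ∷ y ∷ w) (suc i) zero          ()
  linked-lookup-suc (x ∷ y ∷ w) (suc i) (suc j)       eq (_ ∷ l) =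
    linked-lookup-suc (y ∷ w) i j (ℕ.suc-injective eq) l

  linked-lookup-last : ∀ (w : List A) {u} (i : Fin (length w)) → suc (toℕ i) ≡ length w →
                       Linked R (w ++ [ u ]) → R (lookup w i) u
  linked-lookup-last (x ∷ [])    zero    _  (r ∷ [-]) = r
  linked-lookup-last (x ∷ y ∷ w) zero    ()
  linked-lookup-last (x ∷ y ∷ w) (suc i) eq (_ ∷ l)   = linked-lookup-last (y ∷ w) i (ℕ.suc-injective eq) l

-- Chordal graphs

module ChordalSeparation {V : Set} (E : Rel V) (E-sym : ∀ {x y} → E x y → E y x) where

  closedWalk : V → List V → V → List V → List V
  closedWalk u xs v ys = u ∷ xs ++ v ∷ ys ++ [ u ]

  Cycle : V → List V → V → List V → Set
  Cycle u xs v ys = Unique (u ∷ xs ++ v ∷ ys) × Linked E (closedWalk u xs v ys)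

  Separated : V → List V → V → List V → Set
  Separated u xs v ys = E u v ⊎ ∃₂ λ x y → x ∈ˡ xs × y ∈ˡ ys × E x y

  record Chord (w : List V) : Set where
    constructor chord
    field
      before      : List V
      a           : V
      inside      : List V
      b           : V
      after       : List V
      split       : w ≡ before ++ a ∷ inside ++ b ∷ after
      inside≢[]   : inside ≢ []
      not-closing : before ≢ [] ⊎ after ≢ []
      edge        : E a b

  chord-between : ∀ (w : List V) (i j : Fin (length w)) → toℕ i < toℕ j →
                  ¬ CycNext (length w) i j → ¬ CycNext (length w) j i →
                  E (lookup w i) (lookup w j) → Chord w
  chord-between (x ∷ w) zero (suc j) _ ¬ij ¬ji e with Q , R , eq , len , last ← split-at w j =
    chord [] x Q _ R (cong (x ∷_) eq) Q≢[] (inj₂ R≢[]) e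
    where
    Q≢[] : Q ≢ []
    Q≢[] refl = ¬ij (inj₁ (cong suc (sym len)))
    R≢[] : R ≢ []
    R≢[] R≡[] = ¬ji (inj₂ (cong suc (last R≡[]) , refl))
  chord-between (x ∷ w) (suc i) (suc j) (s≤s i<j) ¬ij _ e
    with P , Q , R , eq , Q≢[] ← split-at₂ w i j i<j (λ eq → ¬ij (inj₁ (cong suc eq))) =
    chord (x ∷ P) _ Q _ R (cong (x ∷_) eq) Q≢[] (inj₁ λ ()) e

  chordal⇒chord : Chordal E → ∀ u l → 3 ≤ length l →
                  Unique (u ∷ l) → Linked E (u ∷ l ++ [ u ]) → Chord (u ∷ l)
  chordal⇒chord χ u l 3≤l uniq walk
    with χ (length (u ∷ l)) (s≤s 3≤l) (lookup (u ∷ l)) (lookup-injective uniq , adjacent)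
    where
    adjacent : ∀ i j → CycNext (length (u ∷ l)) i j → E (lookup (u ∷ l) i) (lookup (u ∷ l) j)
    adjacent i j       (inj₁ j≡1+i)      = linked-lookup-suc (u ∷ l) i j j≡1+i walk
    adjacent i zero    (inj₂ (last , _)) = linked-lookup-last (u ∷ l) i last walk
    adjacent i (suc j) (inj₂ (_ , ()))
  ... | i , j , i≢j , ¬ij , ¬ji , e with ℕ.<-cmp (toℕ i) (toℕ j)
  ... | tri< i<j _ _ = chord-between (u ∷ l) i j i<j ¬ij ¬ji e
  ... | tri≈ _ i≡j _ = ⊥-elim (i≢j (Fin.toℕ-injective i≡j))
  ... | tri> _ _ j<i = chord-between (u ∷ l) j i j<i ¬ji ¬ij (E-sym e)

  closedWalk-++ˡ : ∀ u p T v ys → closedWalk u (p ++ T) v ys ≡ (u ∷ p) ++ T ++ v ∷ ys ++ [ u ]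
  closedWalk-++ˡ u p T v ys = cong (u ∷_) (++-assoc p T _)

  closedWalk-++ʳ : ∀ u xs v m T → closedWalk u xs v (m ++ T) ≡ (u ∷ xs ++ v ∷ m) ++ T ++ [ u ]
  closedWalk-++ʳ u xs v m T =
    cong (u ∷_) (trans (cong (λ t → xs ++ v ∷ t) (++-assoc m T [ u ])) (sym (++-assoc xs (v ∷ m) _)))

  data Step (u : V) (xs : List V) (v : V) (ys : List V) : Set where
    separated : Separated u xs v ys → Step u xs v ys
    shortened : ∀ {xs′ ys′} → xs′ ⊑ xs → ys′ ⊑ ys → xs′ ≢ [] → ys′ ≢ [] →
                length (closedWalk u xs′ v ys′) < length (closedWalk u xs v ys) →
                Linked E (closedWalk u xs′ v ys′) → Step u xs v ys

  shorten : ∀ {u xs v ys xs′ ys′} → xs′ ⊑ xs → ys′ ⊑ ys → xs′ ≢ [] → ys′ ≢ [] →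
            ∀ P a Q b R → closedWalk u xs v ys ≡ P ++ a ∷ Q ++ b ∷ R →
            closedWalk u xs′ v ys′ ≡ P ++ a ∷ b ∷ R → Q ≢ [] → E a b →
            Linked E (closedWalk u xs v ys) → Step u xs v ys
  shorten τ σ xs′≢[] ys′≢[] P a Q b R eq eq′ Q≢[] e walk =
    shortened τ σ xs′≢[] ys′≢[]
      (subst₂ _<_ (cong length (sym eq′)) (cong length (sym eq)) (shortcut-shorter P {a} Q {b} {R} Q≢[]))
      (subst (Linked E) (sym eq′) (linked-shortcut P Q e (subst (Linked E) eq walk)))

  step-from-head : ∀ {u xs v ys} q b r → xs ++ v ∷ ys ≡ q ++ b ∷ r → q ≢ [] → r ≢ [] → E u b →
                   xs ≢ [] → ys ≢ [] → Linked E (closedWalk u xs v ys) → Step u xs v ys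
  step-from-head {u} {xs} {v} {ys} q b r eq q≢[] r≢[] e xs≢[] ys≢[] walk with locate q b r xs v ys (sym eq)
  ... | in-left m refl refl =
    shorten (++⁺ˡ q ⊆-refl) ⊆-refl (λ ()) ys≢[] [] u q b (m ++ v ∷ ys ++ [ u ])
      (closedWalk-++ˡ u q (b ∷ m) v ys) refl q≢[] e walk
  ... | at-pivot refl refl refl = separated (inj₁ e)
  -- the chord is used backwards, as a shortcut from b to the closing copy of u
  ... | in-right m refl refl =
    shorten ⊆-refl (++⁺ ⊆-refl (refl ∷ Sublist.minimum r)) xs≢[] (++-∷≢[] m) (u ∷ xs ++ v ∷ m) b r u []
      (closedWalk-++ʳ u xs v m (b ∷ r)) (closedWalk-++ʳ u xs v m [ b ]) r≢[] (E-sym e) walk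

  step-inside : ∀ {u xs v ys} p a q b r → xs ++ v ∷ ys ≡ p ++ a ∷ q ++ b ∷ r → q ≢ [] → E a b →
                xs ≢ [] → ys ≢ [] → Linked E (closedWalk u xs v ys) → Step u xs v ys
  step-inside {u} {xs} {v} {ys} p a q b r eq q≢[] e xs≢[] ys≢[] walk with locate p a (q ++ b ∷ r) xs v ys (sym eq)
  ... | at-pivot refl refl refl =
    shorten ⊆-refl (++⁺ˡ q ⊆-refl) xs≢[] (λ ()) (u ∷ xs) v q b (r ++ [ u ])
      (cong (λ t → u ∷ xs ++ v ∷ t) (++-assoc q (b ∷ r) [ u ])) refl q≢[] e walk
  ... | in-right m refl refl =
    shorten ⊆-refl (++⁺ ⊆-refl (refl ∷ ++⁺ˡ q ⊆-refl)) xs≢[] (++-∷≢[] m) (u ∷ xs ++ v ∷ m) a q b (r ++ [ u ])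
      (trans (closedWalk-++ʳ u xs v m (a ∷ q ++ b ∷ r))
             (cong (λ t → (u ∷ xs ++ v ∷ m) ++ a ∷ t) (++-assoc q (b ∷ r) [ u ])))
      (closedWalk-++ʳ u xs v m (a ∷ b ∷ r)) q≢[] e walk
  ... | in-left m refl eq′ with locate q b r m v ys eq′
  ...   | in-left n refl refl =
    shorten (++⁺ ⊆-refl (refl ∷ ++⁺ˡ q ⊆-refl)) ⊆-refl (++-∷≢[] p) ys≢[] (u ∷ p) a q b (n ++ v ∷ ys ++ [ u ])
      (trans (closedWalk-++ˡ u p (a ∷ q ++ b ∷ n) v ys)
             (cong (λ t → (u ∷ p) ++ a ∷ t) (++-assoc q (b ∷ n) _)))
      (closedWalk-++ˡ u p (a ∷ b ∷ n) v ys) q≢[] e walk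
  ...   | at-pivot refl refl refl =
    shorten (++⁺ ⊆-refl (refl ∷ Sublist.minimum q)) ⊆-refl (++-∷≢[] p) ys≢[] (u ∷ p) a q v (ys ++ [ u ])
      (closedWalk-++ˡ u p (a ∷ q) v ys) (closedWalk-++ˡ u p [ a ] v ys) q≢[] e walk
  ...   | in-right n refl refl =
    separated (inj₂ (a , b , ∈-++⁺ʳ p (here refl) , ∈-++⁺ʳ n (here refl) , e))

  step : ∀ {u xs v ys} → xs ≢ [] → ys ≢ [] → Linked E (closedWalk u xs v ys) →
         Chord (u ∷ xs ++ v ∷ ys) → Step u xs v ys
  step _ _ _ (chord [] _ _ _ _ _ _ (inj₁ []≢[]) _) = ⊥-elim ([]≢[] refl)
  step xs≢[] ys≢[] walk (chord [] _ q b r eq q≢[] (inj₂ r≢[]) e) with refl , eq′ ← ∷-injective eq =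
    step-from-head q b r eq′ q≢[] r≢[] e xs≢[] ys≢[] walk
  step xs≢[] ys≢[] walk (chord (_ ∷ p) a q b r eq q≢[] _ e) with refl , eq′ ← ∷-injective eq =
    step-inside p a q b r eq′ q≢[] e xs≢[] ys≢[] walk

  separation-acc : Chordal E → ∀ {u xs v ys} → Acc _<_ (length (closedWalk u xs v ys)) →
                   xs ≢ [] → ys ≢ [] → Cycle u xs v ys → Separated u xs v ys
  separation-acc χ {u} {xs} {v} {ys} (acc rec) xs≢[] ys≢[] (uniq , walk)
    with step xs≢[] ys≢[] walk
           (chordal⇒chord χ u _ (length-++-∷≥3 xs≢[] ys≢[]) uniq
             (subst (λ t → Linked E (u ∷ t)) (sym (++-assoc xs (v ∷ ys) [ u ])) walk))
  ... | separated s = s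
  ... | shortened τ σ xs′≢[] ys′≢[] shorter walk′
    with separation-acc χ (rec shorter) xs′≢[] ys′≢[] (Unique-resp-⊇ (refl ∷ ++⁺ τ (refl ∷ σ)) uniq , walk′)
  ...   | inj₁ uv                        = inj₁ uv
  ...   | inj₂ (x , y , x∈xs′ , y∈ys′ , xy) =
    inj₂ (x , y , Sublist.lookup τ x∈xs′ , Sublist.lookup σ y∈ys′ , xy)

  separation : Chordal E → ∀ {u xs v ys} → xs ≢ [] → ys ≢ [] → Cycle u xs v ys → Separated u xs v ys
  separation χ = separation-acc χ (<-wellFounded _)

Next : ℕ → ℕ → ℕ → Set
Next m a b = (b ≡ suc a) ⊎ ((suc a ≡ m) × (b ≡ 0))

next : ∀ m a → a < m → ∃[ b ] b < m × Next m a b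
next m a a<m with suc a <? m
... | yes 1+a<m = suc a , 1+a<m , inj₁ refl
... | no  1+a≮m = 0 , ℕ.≤-trans (s≤s z≤n) a<m , inj₂ (ℕ.≤-antisym a<m (ℕ.≮⇒≥ 1+a≮m) , refl)

previous : ∀ m b → b < m → ∃[ a ] a < m × Next m a b
previous (suc m) zero    _   = m , ℕ.≤-refl , inj₂ (refl , refl)
previous m       (suc b) b<m = b , ℕ.<-trans (ℕ.n<1+n b) b<m , inj₁ refl

neighbours-apart : ∀ k a i b → Next (4 + k) a i → Next (4 + k) i b →
                   a ≢ b × ¬ Next (4 + k) a b × ¬ Next (4 + k) b a
neighbours-apart k a _ _ (inj₁ refl) (inj₁ refl) = ℕ.m≢1+n+m a , a↛2+a , 2+a↛a
  where
  a↛2+a : ¬ Next (4 + k) a (suc (suc a))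
  a↛2+a (inj₁ eq)      = ℕ.m≢1+n+m (suc a) {0} (sym eq)
  a↛2+a (inj₂ (_ , ()))
  2+a↛a : ¬ Next (4 + k) (suc (suc a)) a
  2+a↛a (inj₁ eq)         = ℕ.m≢1+n+m a {2} eq
  2+a↛a (inj₂ (() , refl))
neighbours-apart k _ _ _ (inj₁ refl) (inj₂ (refl , refl)) = (λ ()) , a↛0 , 0↛a
  where
  a↛0 : ¬ Next (4 + k) (2 + k) 0
  a↛0 (inj₁ ())
  a↛0 (inj₂ (eq , _)) = ℕ.m≢1+n+m (3 + k) {0} eq
  0↛a : ¬ Next (4 + k) 0 (2 + k)
  0↛a (inj₁ ())
  0↛a (inj₂ (() , _))
neighbours-apart k _ _ _ (inj₂ (refl , refl)) (inj₁ refl) = (λ ()) , a↛1 , 1↛a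
  where
  a↛1 : ¬ Next (4 + k) (3 + k) 1
  a↛1 (inj₁ ())
  a↛1 (inj₂ (_ , ()))
  1↛a : ¬ Next (4 + k) 1 (3 + k)
  1↛a (inj₁ ())
  1↛a (inj₂ (() , _))
neighbours-apart k _ _ _ (inj₂ (_ , refl)) (inj₂ (() , _))

toℕ-preimage : ∀ {m n} → n < m → ∃[ j ] toℕ {m} j ≡ n
toℕ-preimage n<m = Fin.fromℕ< n<m , Fin.toℕ-fromℕ< n<m

minimiser : ∀ n (f : Fin (suc n) → ℕ) → ∃[ i ] (∀ j → f i ≤ f j)
minimiser zero    f = zero , λ { zero → ℕ.≤-refl }
minimiser (suc n) f with minimiser n (λ j → f (suc j))
... | i , min with f zero ≤? f (suc i)
... | yes f0≤ = zero , λ { zero → ℕ.≤-refl ; (suc j) → ℕ.≤-trans f0≤ (min j) }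
... | no  f0≰ = suc i , λ { zero → ℕ.<⇒≤ (ℕ.≰⇒> f0≰) ; (suc j) → min j }

-- The lowest-ranked vertex of a cycle sees its two cycle-neighbours joined by a chord.
elimination-rank⇒chordal : {V : Set} (E : Rel V) → (∀ {x y} → E x y → E y x) → (r : V → ℕ) →
  (∀ {v u w} → E v u → E v w → r v ≤ r u → r v ≤ r w → u ≢ w → E u w) → Chordal E
elimination-rank⇒chordal E E-sym r simplicial (suc (suc (suc (suc k)))) (s≤s (s≤s (s≤s (s≤s _)))) c (c-inj , c-adj)
  with i , min ← minimiser (3 + k) (λ i → r (c i))
  with b , b< , i→b ← next (4 + k) (toℕ i) (Fin.toℕ<n i)
  with a , a< , a→i ← previous (4 + k) (toℕ i) (Fin.toℕ<n i)
  with j⁻ , refl ← toℕ-preimage a< | j⁺ , refl ← toℕ-preimage b<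
  with a≢b , ¬ab , ¬ba ← neighbours-apart k _ (toℕ i) _ a→i i→b
  = j⁻ , j⁺ , (λ eq → a≢b (cong toℕ eq)) , ¬ab , ¬ba ,
    simplicial (E-sym (c-adj j⁻ i a→i)) (c-adj i j⁺ i→b) (min j⁻) (min j⁺)
               (λ eq → a≢b (cong toℕ (c-inj j⁻ j⁺ eq)))

-- Partitions into labelled blocks

-- The S(n+1,m+1) = (m+1)·S(n,m+1) + S(n,m) recurrence, read as a way of
-- building every partition of Fin (suc n) into m+1 labelled blocks: either
-- element 0 joins one of the m+1 blocks of a partition of the others, or it
-- forms the new block 0 on its own.
mutual
  partition : ∀ n m → Fin (S n m) → Fin n → Fin m
  partition zero    zero    _ ()
  partition (suc n) (suc m) a = add-first n m (splitAt (suc m * S n (suc m)) a)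

  add-first : ∀ n m → Fin (suc m * S n (suc m)) ⊎ Fin (S n m) → Fin (suc n) → Fin (suc m)
  add-first n m (inj₁ a) zero    = proj₁ (remQuot {suc m} (S n (suc m)) a)
  add-first n m (inj₁ a) (suc i) = partition n (suc m) (proj₂ (remQuot {suc m} (S n (suc m)) a)) i
  add-first n m (inj₂ a) zero    = zero
  add-first n m (inj₂ a) (suc i) = suc (partition n m a i)

mutual
  partition-surjective : ∀ n m a (t : Fin m) → ∃[ i ] partition n m a i ≡ t
  partition-surjective (suc n) (suc m) a t = add-first-surjective n m (splitAt (suc m * S n (suc m)) a) t

  add-first-surjective : ∀ n m s (t : Fin (suc m)) → ∃[ i ] add-first n m s i ≡ t
  add-first-surjective n m (inj₁ a) t
    with i , eq ← partition-surjective n (suc m) (proj₂ (remQuot {suc m} (S n (suc m)) a)) t = suc i , eq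
  add-first-surjective n m (inj₂ a) zero = zero , refl
  add-first-surjective n m (inj₂ a) (suc t)
    with i , eq ← partition-surjective n m a t = suc i , cong suc eq

joins-existing-block : ∀ n m a → ∃[ i ] add-first n m (inj₁ a) (suc i) ≡ add-first n m (inj₁ a) zero
joins-existing-block n m a = partition-surjective n (suc m) _ _

SameBlocks : ∀ {n m} → (Fin n → Fin m) → (Fin n → Fin m) → Set
SameBlocks f g = ∀ i j → (f i ≡ f j → g i ≡ g j) × (g i ≡ g j → f i ≡ f j)

mutual
  partition-injective : ∀ n m a b → SameBlocks (partition n m a) (partition n m b) → a ≡ b
  partition-injective zero    zero    zero zero _ = refl
  partition-injective (suc n) (suc m) a b same =
    trans (sym (join-splitAt N (S n m) a))
      (trans (cong (join N (S n m)) (add-first-injective n m (splitAt N a) (splitAt N b) same))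
             (join-splitAt N (S n m) b))
    where
    N : ℕ
    N = suc m * S n (suc m)

  add-first-injective : ∀ n m s s′ → SameBlocks (add-first n m s) (add-first n m s′) → s ≡ s′
  add-first-injective n m (inj₁ a) (inj₁ b) same =
    cong inj₁ (trans (sym (combine-remQuot {suc m} N a)) (trans (cong (uncurry combine) (cong₂ _,_ block rest))
                                                       (combine-remQuot {suc m} N b)))
    where
    N : ℕ
    N = S n (suc m)
    rest : proj₂ (remQuot {suc m} N a) ≡ proj₂ (remQuot {suc m} N b)
    rest = partition-injective n (suc m) _ _ (λ i j → same (suc i) (suc j))
    block : proj₁ (remQuot {suc m} N a) ≡ proj₁ (remQuot {suc m} N b)
    block with i , eq ← joins-existing-block n m a =
      trans (sym eq) (trans (cong (λ c → partition n (suc m) c i) rest)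
                            (sym (proj₁ (same zero (suc i)) (sym eq))))
  add-first-injective n m (inj₂ a) (inj₂ b) same =
    cong inj₂ (partition-injective n m a b λ i j →
      (λ eq → suc-injective (proj₁ (same (suc i) (suc j)) (cong suc eq))) ,
      (λ eq → suc-injective (proj₂ (same (suc i) (suc j)) (cong suc eq))))
  add-first-injective n m (inj₁ a) (inj₂ b) same with i , eq ← joins-existing-block n m a
    with () ← proj₁ (same zero (suc i)) (sym eq)
  add-first-injective n m (inj₂ a) (inj₁ b) same with i , eq ← joins-existing-block n m b
    with () ← proj₂ (same zero (suc i)) (sym eq)

-- The crossing triangulation of G_k

module _ {k : ℕ} where

  lo hi : Pair k → Fin k
  lo ((a , _) , _) = a
  hi ((_ , b) , _) = b

  data Joins (p : Pair k) (a b : Fin k) : Set where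
    forward  : lo p ≡ a → hi p ≡ b → Joins p a b
    backward : lo p ≡ b → hi p ≡ a → Joins p a b

  joins-self : ∀ p → Joins p (lo p) (hi p)
  joins-self p = forward refl refl

  joins-sym : ∀ {p a b} → Joins p a b → Joins p b a
  joins-sym (forward  lo≡a hi≡b) = backward lo≡a hi≡b
  joins-sym (backward lo≡b hi≡a) = forward lo≡b hi≡a

  joins-∋ˡ : ∀ {p a b} → Joins p a b → InPair a p
  joins-∋ˡ (forward  refl _) = inj₁ refl
  joins-∋ˡ (backward _ refl) = inj₂ refl

  joins-∋ʳ : ∀ {p a b} → Joins p a b → InPair b p
  joins-∋ʳ ab = joins-∋ˡ (joins-sym ab)

  joins-only : ∀ {p a b z} → Joins p a b → InPair z p → z ≡ a ⊎ z ≡ b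
  joins-only (forward  refl refl) (inj₁ refl) = inj₁ refl
  joins-only (forward  refl refl) (inj₂ refl) = inj₂ refl
  joins-only (backward refl refl) (inj₁ refl) = inj₂ refl
  joins-only (backward refl refl) (inj₂ refl) = inj₁ refl

  joins-∌ : ∀ {p a b z} → Joins p a b → z ≢ a → z ≢ b → ¬ InPair z p
  joins-∌ ab z≢a z≢b z∈p with joins-only ab z∈p
  ... | inj₁ z≡a = z≢a z≡a
  ... | inj₂ z≡b = z≢b z≡b

  ordered : ∀ p {a b} → lo p ≡ a → hi p ≡ b → toℕ a < toℕ b
  ordered (_ , lo<hi) refl refl = lo<hi

  joins-distinct : ∀ {p a b} → Joins p a b → a ≢ b
  joins-distinct {p} (forward  lo≡a hi≡b) refl = ℕ.<-irrefl refl (ordered p lo≡a hi≡b)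
  joins-distinct {p} (backward lo≡b hi≡a) refl = ℕ.<-irrefl refl (ordered p lo≡b hi≡a)

  joins-member : ∀ {p e} → InPair e p → ∃[ c ] Joins p e c
  joins-member {p} (inj₁ refl) = hi p , forward refl refl
  joins-member {p} (inj₂ refl) = lo p , backward refl refl

  pair : ∀ a b → a ≢ b → ∃[ p ] Joins p a b
  pair a b a≢b with ℕ.<-cmp (toℕ a) (toℕ b)
  ... | tri< a<b _ _ = ((a , b) , a<b) , forward refl refl
  ... | tri≈ _ a≡b _ = ⊥-elim (a≢b (Fin.toℕ-injective a≡b))
  ... | tri> _ _ b<a = ((b , a) , b<a) , backward refl refl

  pair-≡ : ∀ p q → lo p ≡ lo q → hi p ≡ hi q → p ≡ q
  pair-≡ ((a , b) , a<b) ((_ , _) , a<b′) refl refl = cong ((a , b) ,_) (ℕ.<-irrelevant a<b a<b′)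

  joins-unique : ∀ {p q a b} → Joins p a b → Joins q a b → p ≡ q
  joins-unique {p} {q} (forward  lo≡a hi≡b) (forward  lo′≡a hi′≡b) =
    pair-≡ p q (trans lo≡a (sym lo′≡a)) (trans hi≡b (sym hi′≡b))
  joins-unique {p} {q} (backward lo≡b hi≡a) (backward lo′≡b hi′≡a) =
    pair-≡ p q (trans lo≡b (sym lo′≡b)) (trans hi≡a (sym hi′≡a))
  joins-unique {p} {q} (forward  lo≡a hi≡b) (backward lo′≡b hi′≡a) =
    ⊥-elim (ℕ.<-asym (ordered p lo≡a hi≡b) (ordered q lo′≡b hi′≡a))
  joins-unique {p} {q} (backward lo≡b hi≡a) (forward  lo′≡a hi′≡b) =
    ⊥-elim (ℕ.<-asym (ordered p lo≡b hi≡a) (ordered q lo′≡a hi′≡b))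

  inj₁-≢ : ∀ {a b : Fin k} → a ≢ b → inj₁ {B = Pair k} a ≢ inj₁ b
  inj₁-≢ a≢b refl = a≢b refl

  inj₂-≢ : ∀ {p q} {z : Fin k} → InPair z p → ¬ InPair z q → inj₂ {A = Fin k} p ≢ inj₂ q
  inj₂-≢ z∈p z∉q refl = z∉q z∈p

other-labels : (t : Fin 3) → ∃[ t₁ ] ∃[ t₂ ] t₁ ≢ t × t₂ ≢ t × t₁ ≢ t₂
other-labels zero             = suc zero , suc (suc zero) , (λ ()) , (λ ()) , (λ ())
other-labels (suc zero)       = zero , suc (suc zero) , (λ ()) , (λ ()) , (λ ())
other-labels (suc (suc zero)) = zero , suc zero , (λ ()) , (λ ()) , (λ ())

two-of-three : ∀ {p q r s : Fin 3} → p ≢ q → r ≢ s → p ≡ r ⊎ p ≡ s ⊎ q ≡ r ⊎ q ≡ s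
two-of-three {p} {q} {r} {s} p≢q r≢s
  with Fin.pigeonhole (s≤s (s≤s (s≤s (s≤s z≤n)))) (Vec.lookup (p ∷ q ∷ r ∷ s ∷ []))
... | zero             , suc zero             , _ , eq = ⊥-elim (p≢q eq)
... | zero             , suc (suc zero)       , _ , eq = inj₁ eq
... | zero             , suc (suc (suc zero)) , _ , eq = inj₂ (inj₁ eq)
... | suc zero         , suc (suc zero)       , _ , eq = inj₂ (inj₂ (inj₁ eq))
... | suc zero         , suc (suc (suc zero)) , _ , eq = inj₂ (inj₂ (inj₂ eq))
... | suc (suc zero)   , suc (suc (suc zero)) , _ , eq = ⊥-elim (r≢s eq)
... | suc zero         , suc zero             , s≤s () , _
... | suc (suc _)      , suc zero             , s≤s () , _
... | suc (suc _)      , suc (suc zero)       , s≤s (s≤s ()) , _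
... | suc (suc (suc _)) , suc (suc (suc zero)) , s≤s (s≤s (s≤s ())) , _

∈⇒¬∉ : {V : Set} {A : Subset V} {v : V} → v ∈ A → ¬ v ∉ A
∈⇒¬∉ v∈A v∉A with () ← trans (sym v∈A) v∉A

module CrossingTriangulation (k : ℕ) (L : Fin k → Fin 3) where

  Crossing : Pair k → Set
  Crossing p = L (lo p) ≢ L (hi p)

  crossing? : ∀ p → Dec (Crossing p)
  crossing? p = ¬? (L (lo p) Fin.≟ L (hi p))

  same-block : ∀ p → ¬ Crossing p → L (lo p) ≡ L (hi p)
  same-block p = decidable-stable (L (lo p) Fin.≟ L (hi p))

  Ω : Subset (Vk k)
  Ω (inj₁ _) = false
  Ω (inj₂ p) = does (crossing? p)

  crossing⇒∈Ω : ∀ p → Crossing p → inj₂ p ∈ Ω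
  crossing⇒∈Ω p = dec-true (crossing? p)

  ∈Ω⇒crossing : ∀ p → inj₂ p ∈ Ω → Crossing p
  ∈Ω⇒crossing p p∈Ω same with () ← trans (sym p∈Ω) (cong not (dec-true (L (lo p) Fin.≟ L (hi p)) same))

  joins-crossing : ∀ {p a b} → Joins p a b → L a ≢ L b → Crossing p
  joins-crossing (forward  refl refl) La≢Lb = La≢Lb
  joins-crossing (backward refl refl) La≢Lb = La≢Lb ∘ sym

  crossing-joins : ∀ {p a b} → Joins p a b → Crossing p → L a ≢ L b
  crossing-joins (forward  refl refl) c = c
  crossing-joins (backward refl refl) c = c ∘ sym

  data Sees (a : Fin k) (p : Pair k) : Set where
    member     : InPair a p → Sees a p
    below-mate : Crossing p → ∀ {e} → InPair e p → L e ≡ L a → toℕ a < toℕ e → Sees a p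

  H : Rel (Vk k)
  H (inj₁ a) (inj₁ b) = a ≢ b × L a ≡ L b
  H (inj₁ a) (inj₂ p) = Sees a p
  H (inj₂ p) (inj₁ a) = Sees a p
  H (inj₂ p) (inj₂ q) = p ≢ q × Crossing p × Crossing q

  H-sym : ∀ {x y} → H x y → H y x
  H-sym {inj₁ a} {inj₁ b} (a≢b , La≡Lb) = (λ b≡a → a≢b (sym b≡a)) , sym La≡Lb
  H-sym {inj₁ a} {inj₂ p} s = s
  H-sym {inj₂ p} {inj₁ a} s = s
  H-sym {inj₂ p} {inj₂ q} (p≢q , cp , cq) = (λ q≡p → p≢q (sym q≡p)) , cq , cp

  H-irrefl : ∀ v → ¬ H v v
  H-irrefl (inj₁ a) (a≢a , _) = a≢a refl
  H-irrefl (inj₂ p) (p≢p , _) = p≢p refl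

  G⊆H : ∀ u v → Gk k u v → H u v
  G⊆H (inj₁ a) (inj₂ p) a∈p = member a∈p
  G⊆H (inj₂ p) (inj₁ a) a∈p = member a∈p

  rank : Vk k → ℕ
  rank (inj₁ a) = k ∸ toℕ a
  rank (inj₂ p) = if Ω (inj₂ p) then suc k else 0

  rank-crossing : ∀ p → Crossing p → rank (inj₂ p) ≡ suc k
  rank-crossing p c rewrite crossing⇒∈Ω p c = refl

  rank-same-block : ∀ p → ¬ Crossing p → rank (inj₂ p) ≡ 0
  rank-same-block p ¬c rewrite dec-false (crossing? p) ¬c = refl

  rank-element : ∀ a → 0 < rank (inj₁ a) × rank (inj₁ a) < suc k
  rank-element a = ℕ.m<n⇒0<n∸m (Fin.toℕ<n a) , s≤s (ℕ.m∸n≤m k (toℕ a))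

  rank-below : ∀ a b → a ≢ b → rank (inj₁ a) ≤ rank (inj₁ b) → toℕ b < toℕ a
  rank-below a b a≢b ra≤rb with ℕ.<-cmp (toℕ b) (toℕ a)
  ... | tri< b<a _ _ = b<a
  ... | tri≈ _ b≡a _ = ⊥-elim (a≢b (sym (Fin.toℕ-injective b≡a)))
  ... | tri> _ _ a<b = ⊥-elim (ℕ.<⇒≱ (ℕ.∸-monoʳ-< a<b (ℕ.<⇒≤ (Fin.toℕ<n b))) ra≤rb)

  crossing-above : ∀ a p → rank (inj₁ a) ≤ rank (inj₂ p) → Crossing p
  crossing-above a p ra≤rp with crossing? p
  ... | yes c  = c
  ... | no ¬c  =
    ⊥-elim (ℕ.<⇒≱ (proj₁ (rank-element a)) (subst (rank (inj₁ a) ≤_) (rank-same-block p ¬c) ra≤rp))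

  not-above-crossing : ∀ a p → Crossing p → ¬ rank (inj₂ p) ≤ rank (inj₁ a)
  not-above-crossing a p c rp≤ra =
    ℕ.<⇒≱ (proj₂ (rank-element a)) (subst (_≤ rank (inj₁ a)) (rank-crossing p c) rp≤ra)

  sees-same-block : ∀ a p → ¬ Crossing p → Sees a p → InPair a p
  sees-same-block a p ¬c (member a∈p)         = a∈p
  sees-same-block a p ¬c (below-mate c _ _ _) = ⊥-elim (¬c c)

  members-same-block : ∀ p {a b} → ¬ Crossing p → InPair a p → InPair b p → L a ≡ L b
  members-same-block p ¬c (inj₁ refl) (inj₁ refl) = refl
  members-same-block p ¬c (inj₁ refl) (inj₂ refl) = same-block p ¬c
  members-same-block p ¬c (inj₂ refl) (inj₁ refl) = sym (same-block p ¬c)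
  members-same-block p ¬c (inj₂ refl) (inj₂ refl) = refl

  sees-downward : ∀ a b p → L a ≡ L b → toℕ b < toℕ a → Crossing p → Sees a p → Sees b p
  sees-downward a b p La≡Lb b<a c (member a∈p) = below-mate c a∈p La≡Lb b<a
  sees-downward a b p La≡Lb b<a c (below-mate _ e∈p Le≡La a<e) =
    below-mate c e∈p (trans Le≡La La≡Lb) (ℕ.<-trans b<a a<e)

  higher-neighbours-adjacent : ∀ {v u w} → H v u → H v w → rank v ≤ rank u → rank v ≤ rank w → u ≢ w → H u w
  higher-neighbours-adjacent {inj₂ p} {u} {w} hu hw ru rw u≢w with crossing? p
  higher-neighbours-adjacent {inj₂ p} {inj₁ a} hu hw ru rw u≢w | yes c = ⊥-elim (not-above-crossing a p c ru)
  higher-neighbours-adjacent {inj₂ p} {inj₂ q} {inj₁ b} hu hw ru rw u≢w | yes c = ⊥-elim (not-above-crossing b p c rw)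
  higher-neighbours-adjacent {inj₂ p} {inj₂ q} {inj₂ q′} (_ , _ , cq) (_ , _ , cq′) ru rw u≢w | yes c =
    (λ q≡q′ → u≢w (cong inj₂ q≡q′)) , cq , cq′
  higher-neighbours-adjacent {inj₂ p} {inj₂ q} (_ , c , _) hw ru rw u≢w | no ¬c = ⊥-elim (¬c c)
  higher-neighbours-adjacent {inj₂ p} {inj₁ a} {inj₂ q} hu (_ , c , _) ru rw u≢w | no ¬c = ⊥-elim (¬c c)
  higher-neighbours-adjacent {inj₂ p} {inj₁ a} {inj₁ b} hu hw ru rw u≢w | no ¬c =
    (λ a≡b → u≢w (cong inj₁ a≡b)) , members-same-block p ¬c (sees-same-block a p ¬c hu) (sees-same-block b p ¬c hw)
  higher-neighbours-adjacent {inj₁ a} {inj₁ b} {inj₁ c} (_ , La≡Lb) (_ , La≡Lc) ru rw u≢w =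
    (λ b≡c → u≢w (cong inj₁ b≡c)) , trans (sym La≡Lb) La≡Lc
  higher-neighbours-adjacent {inj₁ a} {inj₁ b} {inj₂ q} (a≢b , La≡Lb) hw ru rw u≢w =
    sees-downward a b q La≡Lb (rank-below a b a≢b ru) (crossing-above a q rw) hw
  higher-neighbours-adjacent {inj₁ a} {inj₂ q} {inj₁ b} hu (a≢b , La≡Lb) ru rw u≢w =
    sees-downward a b q La≡Lb (rank-below a b a≢b rw) (crossing-above a q ru) hu
  higher-neighbours-adjacent {inj₁ a} {inj₂ q} {inj₂ q′} hu hw ru rw u≢w =
    (λ q≡q′ → u≢w (cong inj₂ q≡q′)) , crossing-above a q ru , crossing-above a q′ rw

  H-triangulation : IsTriangulation (Gk k) H
  H-triangulation = ((λ _ _ → H-sym) , H-irrefl) , G⊆H ,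
                    elimination-rank⇒chordal H H-sym rank higher-neighbours-adjacent

  Ω-clique : IsClique H Ω
  Ω-clique (inj₂ p) (inj₂ q) p∈Ω q∈Ω p≢q =
    (λ p≡q → p≢q (cong inj₂ p≡q)) , ∈Ω⇒crossing p p∈Ω , ∈Ω⇒crossing q q∈Ω

  Ω-free : IsFree (Gk k) Ω
  Ω-free (inj₂ p) _ = inj₁ (lo p) , refl , inj₁ refl

  Ω-no-elements : ∀ i → inj₁ i ∉ Ω
  Ω-no-elements _ = refl

  module Surjective (surj : ∀ t → ∃[ i ] L i ≡ t) where

    crossing-pair-avoiding : ∀ t → ∃[ p ] Crossing p × (∀ {z} → InPair z p → L z ≢ t)
    crossing-pair-avoiding t
      with t₁ , t₂ , t₁≢t , t₂≢t , t₁≢t₂ ← other-labels t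
      with b , refl ← surj t₁ | c , refl ← surj t₂
      with p , bc ← pair b c (λ b≡c → t₁≢t₂ (cong L b≡c))
      = p , joins-crossing bc t₁≢t₂ , avoids
      where
      avoids : ∀ {z} → InPair z p → L z ≢ t
      avoids z∈p with joins-only bc z∈p
      ... | inj₁ refl = t₁≢t
      ... | inj₂ refl = t₂≢t

    outside-Ω-unseen : ∀ v → v ∉ Ω → ∃[ w ] w ∈ Ω × ¬ H v w
    outside-Ω-unseen (inj₁ a) _ with p , c , avoids ← crossing-pair-avoiding (L a) =
      inj₂ p , crossing⇒∈Ω p c , unseen
      where
      unseen : ¬ Sees a p
      unseen (member a∈p)             = avoids a∈p refl
      unseen (below-mate _ e∈p Le≡La _) = avoids e∈p Le≡La
    outside-Ω-unseen (inj₂ q) q∉Ω with p , c , _ ← crossing-pair-avoiding zero =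
      inj₂ p , crossing⇒∈Ω p c , λ (_ , cq , _) → ∈⇒¬∉ {A = Ω} {inj₂ q} (crossing⇒∈Ω q cq) q∉Ω

    Ω-maximal : IsMaximalClique H Ω
    Ω-maximal = Ω-clique , maximal
      where
      maximal : (Ω′ : Subset (Vk k)) → IsClique H Ω′ → Ω ⊆ Ω′ → Ω′ ⊆ Ω
      maximal Ω′ clique Ω⊆Ω′ v v∈Ω′ with Ω v in v∈?Ω
      ... | true  = refl
      ... | false with w , w∈Ω , ¬vw ← outside-Ω-unseen v v∈?Ω
        = ⊥-elim (¬vw (clique v w v∈Ω′ (Ω⊆Ω′ w w∈Ω) λ { refl → ∈⇒¬∉ {A = Ω} {v} w∈Ω v∈?Ω }))

    module Forced (H′ : Rel (Vk k)) (H′-triangulation : IsTriangulation (Gk k) H′)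
                  (H′⊆H : ∀ u v → H′ u v → H u v) where

      H′-sym : ∀ {x y} → H′ x y → H′ y x
      H′-sym {x} {y} = proj₁ (proj₁ H′-triangulation) x y

      G⊆H′ : ∀ {x y} → Gk k x y → H′ x y
      G⊆H′ {x} {y} = proj₁ (proj₂ H′-triangulation) x y

      open ChordalSeparation H′ H′-sym using (Cycle; separation)

      forced : ∀ {u xs v ys} → xs ≢ [] → ys ≢ [] → Cycle u xs v ys →
               (∀ {x y} → x ∈ˡ xs → y ∈ˡ ys → ¬ H x y) → H′ u v
      forced xs≢[] ys≢[] cycle unseparated with separation (proj₂ (proj₂ H′-triangulation)) xs≢[] ys≢[] cycle
      ... | inj₁ uv = uv
      ... | inj₂ (x , y , x∈xs , y∈ys , xy) = ⊥-elim (unseparated x∈xs y∈ys (H′⊆H x y xy))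

      same-block-triangle : ∀ {a b c pab pbc pac} → Joins pab a b → Joins pbc b c → Joins pac a c →
                            L a ≡ L b → H′ (inj₁ a) (inj₁ b)
      same-block-triangle {a} {b} {c} {pab} {pbc} {pac} ab bc ac La≡Lb = forced (λ ()) (λ ()) cycle unseparated
        where
        a≢b : a ≢ b
        a≢b = joins-distinct ab
        b≢c : b ≢ c
        b≢c = joins-distinct bc
        a≢c : a ≢ c
        a≢c = joins-distinct ac
        ¬cross : ¬ Crossing pab
        ¬cross cross = crossing-joins ab cross La≡Lb
        cycle : Cycle (inj₁ a) (inj₂ pab ∷ []) (inj₁ b) (inj₂ pbc ∷ inj₁ c ∷ inj₂ pac ∷ [])
        cycle =
          ( ((λ ()) ∷ inj₁-≢ a≢b ∷ (λ ()) ∷ inj₁-≢ a≢c ∷ (λ ()) ∷ [])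
          ∷ ((λ ()) ∷ inj₂-≢ (joins-∋ˡ ab) (joins-∌ bc a≢b a≢c) ∷ (λ ()) ∷
             inj₂-≢ (joins-∋ʳ ab) (joins-∌ ac (a≢b ∘ sym) b≢c) ∷ [])
          ∷ ((λ ()) ∷ inj₁-≢ b≢c ∷ (λ ()) ∷ [])
          ∷ ((λ ()) ∷ inj₂-≢ (joins-∋ˡ bc) (joins-∌ ac (a≢b ∘ sym) b≢c) ∷ [])
          ∷ ((λ ()) ∷ [])
          ∷ [] ∷ [])
          , G⊆H′ (joins-∋ˡ ab) ∷ G⊆H′ (joins-∋ʳ ab) ∷ G⊆H′ (joins-∋ˡ bc) ∷ G⊆H′ (joins-∋ʳ bc)
          ∷ G⊆H′ (joins-∋ʳ ac) ∷ G⊆H′ (joins-∋ˡ ac) ∷ [-]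
        unseparated : ∀ {x y} → x ∈ˡ inj₂ pab ∷ [] → y ∈ˡ inj₂ pbc ∷ inj₁ c ∷ inj₂ pac ∷ [] → ¬ H x y
        unseparated (here refl) (here refl)                 (_ , cross , _)          = ¬cross cross
        unseparated (here refl) (there (here refl))         (member c∈pab)           =
          joins-∌ ab (a≢c ∘ sym) (b≢c ∘ sym) c∈pab
        unseparated (here refl) (there (here refl))         (below-mate cross _ _ _) = ¬cross cross
        unseparated (here refl) (there (there (here refl))) (_ , cross , _)          = ¬cross cross

      below-mate-triangle : ∀ {a e c p pae pac} → Joins p e c → Joins pae a e → Joins pac a c →
                            L e ≡ L a → toℕ a < toℕ e → L e ≢ L c → H′ (inj₁ a) (inj₂ p)
      below-mate-triangle {a} {e} {c} {p} {pae} {pac} ec ae ac Le≡La a<e Le≢Lc =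
        forced (λ ()) (λ ()) cycle unseparated
        where
        a≢e : a ≢ e
        a≢e = joins-distinct ae
        a≢c : a ≢ c
        a≢c = joins-distinct ac
        e≢c : e ≢ c
        e≢c = joins-distinct ec
        ¬cross : ¬ Crossing pae
        ¬cross cross = crossing-joins ae cross (sym Le≡La)
        cycle : Cycle (inj₁ a) (inj₂ pae ∷ inj₁ e ∷ []) (inj₂ p) (inj₁ c ∷ inj₂ pac ∷ [])
        cycle =
          ( ((λ ()) ∷ inj₁-≢ a≢e ∷ (λ ()) ∷ inj₁-≢ a≢c ∷ (λ ()) ∷ [])
          ∷ ((λ ()) ∷ inj₂-≢ (joins-∋ˡ ae) (joins-∌ ec a≢e a≢c) ∷ (λ ()) ∷
             inj₂-≢ (joins-∋ʳ ae) (joins-∌ ac (a≢e ∘ sym) e≢c) ∷ [])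
          ∷ ((λ ()) ∷ inj₁-≢ e≢c ∷ (λ ()) ∷ [])
          ∷ ((λ ()) ∷ inj₂-≢ (joins-∋ˡ ec) (joins-∌ ac (a≢e ∘ sym) e≢c) ∷ [])
          ∷ ((λ ()) ∷ [])
          ∷ [] ∷ [])
          , G⊆H′ (joins-∋ˡ ae) ∷ G⊆H′ (joins-∋ʳ ae) ∷ G⊆H′ (joins-∋ˡ ec) ∷ G⊆H′ (joins-∋ʳ ec)
          ∷ G⊆H′ (joins-∋ʳ ac) ∷ G⊆H′ (joins-∋ˡ ac) ∷ [-]
        unseparated : ∀ {x y} → x ∈ˡ inj₂ pae ∷ inj₁ e ∷ [] → y ∈ˡ inj₁ c ∷ inj₂ pac ∷ [] → ¬ H x y
        unseparated (here refl)         (here refl)         (member c∈pae)           =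
          joins-∌ ae (a≢c ∘ sym) (e≢c ∘ sym) c∈pae
        unseparated (here refl)         (here refl)         (below-mate cross _ _ _) = ¬cross cross
        unseparated (here refl)         (there (here refl)) (_ , cross , _)          = ¬cross cross
        unseparated (there (here refl)) (here refl)         (_ , Le≡Lc)              = Le≢Lc Le≡Lc
        unseparated (there (here refl)) (there (here refl)) (member e∈pac)           =
          joins-∌ ac (a≢e ∘ sym) e≢c e∈pac
        unseparated (there (here refl)) (there (here refl)) (below-mate _ z∈pac Lz≡Le e<z)
          with joins-only ac z∈pac
        ... | inj₁ refl = ℕ.<-asym a<e e<z
        ... | inj₂ refl = Le≢Lc (sym Lz≡Le)

      sharing-triangle : ∀ {e b c x y pbc} → Joins x e b → Joins y e c → Joins pbc b c →
                         L e ≢ L b → L e ≢ L c → H′ (inj₂ x) (inj₂ y)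
      sharing-triangle {e} {b} {c} {x} {y} {pbc} eb ec bc Le≢Lb Le≢Lc =
        forced (λ ()) (λ ()) cycle unseparated
        where
        e≢b : e ≢ b
        e≢b = joins-distinct eb
        e≢c : e ≢ c
        e≢c = joins-distinct ec
        b≢c : b ≢ c
        b≢c = joins-distinct bc
        cycle : Cycle (inj₂ x) (inj₁ e ∷ []) (inj₂ y) (inj₁ c ∷ inj₂ pbc ∷ inj₁ b ∷ [])
        cycle =
          ( ((λ ()) ∷ inj₂-≢ (joins-∋ʳ eb) (joins-∌ ec (e≢b ∘ sym) b≢c) ∷ (λ ()) ∷
             inj₂-≢ (joins-∋ˡ eb) (joins-∌ bc e≢b e≢c) ∷ (λ ()) ∷ [])
          ∷ ((λ ()) ∷ inj₁-≢ e≢c ∷ (λ ()) ∷ inj₁-≢ e≢b ∷ [])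
          ∷ ((λ ()) ∷ inj₂-≢ (joins-∋ˡ ec) (joins-∌ bc e≢b e≢c) ∷ (λ ()) ∷ [])
          ∷ ((λ ()) ∷ inj₁-≢ (b≢c ∘ sym) ∷ [])
          ∷ ((λ ()) ∷ [])
          ∷ [] ∷ [])
          , G⊆H′ (joins-∋ˡ eb) ∷ G⊆H′ (joins-∋ˡ ec) ∷ G⊆H′ (joins-∋ʳ ec) ∷ G⊆H′ (joins-∋ʳ bc)
          ∷ G⊆H′ (joins-∋ˡ bc) ∷ G⊆H′ (joins-∋ʳ eb) ∷ [-]
        unseparated : ∀ {u w} → u ∈ˡ inj₁ e ∷ [] → w ∈ˡ inj₁ c ∷ inj₂ pbc ∷ inj₁ b ∷ [] → ¬ H u w
        unseparated (here refl) (here refl)                 (_ , Le≡Lc)    = Le≢Lc Le≡Lc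
        unseparated (here refl) (there (there (here refl))) (_ , Le≡Lb)    = Le≢Lb Le≡Lb
        unseparated (here refl) (there (here refl))         (member e∈pbc) = joins-∌ bc e≢b e≢c e∈pbc
        unseparated (here refl) (there (here refl))         (below-mate _ z∈pbc Lz≡Le _)
          with joins-only bc z∈pbc
        ... | inj₁ refl = Le≢Lb (sym Lz≡Le)
        ... | inj₂ refl = Le≢Lc (sym Lz≡Le)

      disjoint-square : ∀ {a b c d x y pac pbd} → Joins x a b → Joins y c d → Joins pac a c → Joins pbd b d →
                        L a ≡ L c → L a ≢ L b → L c ≢ L d → H′ (inj₂ x) (inj₂ y)
      disjoint-square {a} {b} {c} {d} {x} {y} {pac} {pbd} ab cd ac bd La≡Lc La≢Lb Lc≢Ld =
        forced (λ ()) (λ ()) cycle unseparated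
        where
        La≢Ld : L a ≢ L d
        La≢Ld La≡Ld = Lc≢Ld (trans (sym La≡Lc) La≡Ld)
        Lc≢Lb : L c ≢ L b
        Lc≢Lb Lc≡Lb = La≢Lb (trans La≡Lc Lc≡Lb)
        a≢b : a ≢ b
        a≢b = joins-distinct ab
        c≢d : c ≢ d
        c≢d = joins-distinct cd
        a≢c : a ≢ c
        a≢c = joins-distinct ac
        b≢d : b ≢ d
        b≢d = joins-distinct bd
        a≢d : a ≢ d
        a≢d a≡d = La≢Ld (cong L a≡d)
        c≢b : c ≢ b
        c≢b c≡b = Lc≢Lb (cong L c≡b)
        ¬cross : ¬ Crossing pac
        ¬cross cross = crossing-joins ac cross La≡Lc
        cycle : Cycle (inj₂ x) (inj₁ a ∷ inj₂ pac ∷ inj₁ c ∷ []) (inj₂ y) (inj₁ d ∷ inj₂ pbd ∷ inj₁ b ∷ [])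
        cycle =
          ( ((λ ()) ∷ inj₂-≢ (joins-∋ʳ ab) (joins-∌ ac (a≢b ∘ sym) (c≢b ∘ sym)) ∷ (λ ()) ∷
             inj₂-≢ (joins-∋ˡ ab) (joins-∌ cd a≢c a≢d) ∷ (λ ()) ∷
             inj₂-≢ (joins-∋ˡ ab) (joins-∌ bd a≢b a≢d) ∷ (λ ()) ∷ [])
          ∷ ((λ ()) ∷ inj₁-≢ a≢c ∷ (λ ()) ∷ inj₁-≢ a≢d ∷ (λ ()) ∷ inj₁-≢ a≢b ∷ [])
          ∷ ((λ ()) ∷ inj₂-≢ (joins-∋ˡ ac) (joins-∌ cd a≢c a≢d) ∷ (λ ()) ∷
             inj₂-≢ (joins-∋ˡ ac) (joins-∌ bd a≢b a≢d) ∷ (λ ()) ∷ [])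
          ∷ ((λ ()) ∷ inj₁-≢ c≢d ∷ (λ ()) ∷ inj₁-≢ c≢b ∷ [])
          ∷ ((λ ()) ∷ inj₂-≢ (joins-∋ˡ cd) (joins-∌ bd c≢b c≢d) ∷ (λ ()) ∷ [])
          ∷ ((λ ()) ∷ inj₁-≢ (b≢d ∘ sym) ∷ [])
          ∷ ((λ ()) ∷ [])
          ∷ [] ∷ [])
          , G⊆H′ (joins-∋ˡ ab) ∷ G⊆H′ (joins-∋ˡ ac) ∷ G⊆H′ (joins-∋ʳ ac) ∷ G⊆H′ (joins-∋ˡ cd)
          ∷ G⊆H′ (joins-∋ʳ cd) ∷ G⊆H′ (joins-∋ʳ bd) ∷ G⊆H′ (joins-∋ˡ bd) ∷ G⊆H′ (joins-∋ʳ ab) ∷ [-]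
        unseen-from-block-of-a : ∀ {z} → L z ≡ L a → ¬ Sees z pbd
        unseen-from-block-of-a Lz≡La (member z∈pbd) with joins-only bd z∈pbd
        ... | inj₁ refl = La≢Lb (sym Lz≡La)
        ... | inj₂ refl = La≢Ld (sym Lz≡La)
        unseen-from-block-of-a Lz≡La (below-mate _ w∈pbd Lw≡Lz _) with joins-only bd w∈pbd
        ... | inj₁ refl = La≢Lb (sym (trans Lw≡Lz Lz≡La))
        ... | inj₂ refl = La≢Ld (sym (trans Lw≡Lz Lz≡La))
        unseen-by-pac : ∀ {z} → z ≢ a → z ≢ c → ¬ Sees z pac
        unseen-by-pac z≢a z≢c (member z∈pac)           = joins-∌ ac z≢a z≢c z∈pac
        unseen-by-pac z≢a z≢c (below-mate cross _ _ _) = ¬cross cross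
        unseparated : ∀ {u w} → u ∈ˡ inj₁ a ∷ inj₂ pac ∷ inj₁ c ∷ [] → w ∈ˡ inj₁ d ∷ inj₂ pbd ∷ inj₁ b ∷ [] →
                      ¬ H u w
        unseparated (here refl)                 (here refl)                 (_ , La≡Ld)     = La≢Ld La≡Ld
        unseparated (here refl)                 (there (here refl))         sees            =
          unseen-from-block-of-a refl sees
        unseparated (here refl)                 (there (there (here refl))) (_ , La≡Lb)     = La≢Lb La≡Lb
        unseparated (there (here refl))         (here refl)                 sees            =
          unseen-by-pac (a≢d ∘ sym) (c≢d ∘ sym) sees
        unseparated (there (here refl))         (there (here refl))         (_ , cross , _) = ¬cross cross
        unseparated (there (here refl))         (there (there (here refl))) sees            =
          unseen-by-pac (a≢b ∘ sym) (c≢b ∘ sym) sees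
        unseparated (there (there (here refl))) (here refl)                 (_ , Lc≡Ld)     = Lc≢Ld Lc≡Ld
        unseparated (there (there (here refl))) (there (here refl))         sees            =
          unseen-from-block-of-a (sym La≡Lc) sees
        unseparated (there (there (here refl))) (there (there (here refl))) (_ , Lc≡Lb)     = Lc≢Lb Lc≡Lb

      same-block-forced : ∀ a b → a ≢ b → L a ≡ L b → H′ (inj₁ a) (inj₁ b)
      same-block-forced a b a≢b La≡Lb
        with t , _ , t≢La , _ ← other-labels (L a)
        with c , refl ← surj t
        with _ , ab ← pair a b a≢b
           | _ , bc ← pair b c (λ b≡c → t≢La (trans (cong L (sym b≡c)) (sym La≡Lb)))
           | _ , ac ← pair a c (λ a≡c → t≢La (cong L (sym a≡c)))
        = same-block-triangle ab bc ac La≡Lb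

      sees-forced : ∀ a p → Sees a p → H′ (inj₁ a) (inj₂ p)
      sees-forced a p (member a∈p) = G⊆H′ a∈p
      sees-forced a p (below-mate cross e∈p Le≡La a<e)
        with c , ec ← joins-member e∈p
        with _ , ae ← pair a _ (λ a≡e → ℕ.<-irrefl (cong toℕ a≡e) a<e)
           | _ , ac ← pair a c (λ a≡c → crossing-joins ec cross (trans Le≡La (cong L a≡c)))
        = below-mate-triangle ec ae ac Le≡La a<e (crossing-joins ec cross)

      sharing-forced : ∀ {e b c x y} → Joins x e b → Joins y e c → x ≢ y → Crossing x → Crossing y →
                       H′ (inj₂ x) (inj₂ y)
      sharing-forced {b = b} {c} eb ec x≢y cx cy
        with _ , bc ← pair b c (λ { refl → x≢y (joins-unique eb ec) })
        = sharing-triangle eb ec bc (crossing-joins eb cx) (crossing-joins ec cy)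

      disjoint-forced : ∀ {a b c d x y} → Joins x a b → Joins y c d → a ≢ c → b ≢ d → L a ≡ L c →
                        Crossing x → Crossing y → H′ (inj₂ x) (inj₂ y)
      disjoint-forced {a} {b} {c} {d} ab cd a≢c b≢d La≡Lc cx cy
        with _ , ac ← pair a c a≢c | _ , bd ← pair b d b≢d
        = disjoint-square ab cd ac bd La≡Lc (crossing-joins ab cx) (crossing-joins cd cy)

      crossings-forced : ∀ x y → x ≢ y → Crossing x → Crossing y → H′ (inj₂ x) (inj₂ y)
      crossings-forced x y x≢y cx cy
        with lo x Fin.≟ lo y | lo x Fin.≟ hi y | hi x Fin.≟ lo y | hi x Fin.≟ hi y
      ... | yes ll | _      | _      | _      = sharing-forced (joins-self x) (forward (sym ll) refl) x≢y cx cy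
      ... | _      | yes lh | _      | _      = sharing-forced (joins-self x) (backward refl (sym lh)) x≢y cx cy
      ... | _      | _      | yes hl | _      =
        sharing-forced (joins-sym (joins-self x)) (forward (sym hl) refl) x≢y cx cy
      ... | _      | _      | _      | yes hh =
        sharing-forced (joins-sym (joins-self x)) (backward refl (sym hh)) x≢y cx cy
      ... | no ll  | no lh  | no hl  | no hh with two-of-three cx cy
      ...   | inj₁ same               = disjoint-forced (joins-self x) (joins-self y) ll hh same cx cy
      ...   | inj₂ (inj₁ same)        =
        disjoint-forced (joins-self x) (joins-sym (joins-self y)) lh hl same cx cy
      ...   | inj₂ (inj₂ (inj₁ same)) =
        disjoint-forced (joins-sym (joins-self x)) (joins-self y) hl lh same cx cy
      ...   | inj₂ (inj₂ (inj₂ same)) =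
        disjoint-forced (joins-sym (joins-self x)) (joins-sym (joins-self y)) hh ll same cx cy

      H⊆H′ : ∀ u v → H u v → H′ u v
      H⊆H′ (inj₁ a) (inj₁ b) (a≢b , La≡Lb)   = same-block-forced a b a≢b La≡Lb
      H⊆H′ (inj₁ a) (inj₂ p) sees            = sees-forced a p sees
      H⊆H′ (inj₂ p) (inj₁ a) sees            = H′-sym (sees-forced a p sees)
      H⊆H′ (inj₂ p) (inj₂ q) (p≢q , cp , cq) = crossings-forced p q p≢q cp cq

    H-minimal : IsMinimalTriangulation (Gk k) H
    H-minimal = H-triangulation , λ H′ H′-triangulation H′⊆H (u , v , Huv , ¬H′uv) →
      ¬H′uv (Forced.H⊆H′ H′ H′-triangulation H′⊆H u v Huv)

    Ω-pmc : IsPMC (Gk k) Ω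
    Ω-pmc = H , H-minimal , Ω-maximal

SameΩ : ∀ {k} → (Fin k → Fin 3) → (Fin k → Fin 3) → Set
SameΩ {k} L L′ = ∀ v → CrossingTriangulation.Ω k L v ≡ CrossingTriangulation.Ω k L′ v

same-Ω⇒same-block : ∀ {k} (L L′ : Fin k → Fin 3) → SameΩ L L′ →
                    ∀ {i j} → toℕ i < toℕ j → L i ≡ L j → L′ i ≡ L′ j
same-Ω⇒same-block {k} L L′ same {i} {j} i<j Li≡Lj =
  T′.same-block p λ c′ → T.∈Ω⇒crossing p (trans (same (inj₂ p)) (T′.crossing⇒∈Ω p c′)) Li≡Lj
  where
  module T  = CrossingTriangulation k L
  module T′ = CrossingTriangulation k L′
  p : Pair k
  p = (i , j) , i<j

same-Ω⇒same-blocks : ∀ {k} (L L′ : Fin k → Fin 3) → SameΩ L L′ → SameBlocks L L′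
same-Ω⇒same-blocks L L′ same i j with ℕ.<-cmp (toℕ i) (toℕ j)
... | tri< i<j _ _ = same-Ω⇒same-block L L′ same i<j , same-Ω⇒same-block L′ L (sym ∘ same) i<j
... | tri≈ _ i≡j _ rewrite Fin.toℕ-injective i≡j = (λ _ → refl) , (λ _ → refl)
... | tri> _ _ j<i = sym ∘ same-Ω⇒same-block L L′ same j<i ∘ sym ,
                     sym ∘ same-Ω⇒same-block L′ L (sym ∘ same) j<i ∘ sym

lemma10 : (k : ℕ) → 1 ≤ k →
    Σ (Fin (S k 3) → Subset (Vk k)) λ f →
      ((a b : Fin (S k 3)) → (∀ v → f a v ≡ f b v) → a ≡ b) ×
      ((a : Fin (S k 3)) →
        IsPMC (Gk k) (f a) × IsFree (Gk k) (f a) × (∀ i → inj₁ i ∉ f a))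
lemma10 k _ = Ω-of , injective , properties
  where
  Ω-of : Fin (S k 3) → Subset (Vk k)
  Ω-of a = CrossingTriangulation.Ω k (partition k 3 a)
  injective : (a b : Fin (S k 3)) → (∀ v → Ω-of a v ≡ Ω-of b v) → a ≡ b
  injective a b same = partition-injective k 3 a b (same-Ω⇒same-blocks _ _ same)
  properties : (a : Fin (S k 3)) → IsPMC (Gk k) (Ω-of a) × IsFree (Gk k) (Ω-of a) × (∀ i → inj₁ i ∉ Ω-of a)
  properties a = Surjective.Ω-pmc (partition-surjective k 3 a) , Ω-free , Ω-no-elements
    where open CrossingTriangulation k (partition k 3 a)
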